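{- Let $G$ be a graph with $\chi(G)={\rm ivs_{\chi}}(G)=3$, ${\rm vs_{\chi}}(G)=2$ and $\chi(G)\ge\frac{\Delta(G)}{2}+1$. Then $\Delta(G)=4$, and for every $v_1,v_2\in V(G)$ such that $\chi(G-\{v_1,v_2\})=2$ we have $\deg_G(v_1)=\deg_G(v_2)=4$.
   Context: All graphs are finite and simple. $\chi(G)$ is the chromatic number and $\Delta(G)$ the maximum degree of $G$. ${\rm vs_{\chi}}(G)$ is the minimum size of a set $S\subseteq V(G)$ such that $\chi(G-S)=\chi(G)-1$; ${\rm ivs_{\chi}}(G)$ is the minimum size of an independent set $S\subseteq V(G)$ such that $\chi(G-S)=\chi(G)-1$. -}

module Defs where

open import Data.Nat using (ℕ; _≤_; _⊔_)
open import Data.Bool using (Bool; true; false)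
open import Data.Fin using (Fin)
open import Data.Fin.Subset using (Subset; _∈_; _∉_; ∣_∣)
open import Data.Vec using (tabulate)
open import Data.List using (foldr; map; allFin)
open import Data.Product using (Σ; _×_; ∃)
open import Relation.Binary.PropositionalEquality using (_≡_; _≢_)
open import Relation.Nullary using (¬_)

record Graph (n : ℕ) : Set where
  field
    adj    : Fin n → Fin n → Bool
    sym    : ∀ u v → adj u v ≡ adj v u
    irrefl : ∀ v → adj v v ≡ false
open Graph public

deg : ∀ {n} → Graph n → Fin n → ℕ
deg G v = ∣ tabulate (adj G v) ∣

Δ : ∀ {n} → Graph n → ℕ
Δ {n} G = foldr _⊔_ 0 (map (deg G) (allFin n))

-- a proper k-colouring of the induced subgraph G - S
-- (colours are assigned only to vertices not in S)
Colouring : ∀ {n} → Graph n → Subset n → ℕ → Set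
Colouring {n} G S k =
  Σ ((v : Fin n) → v ∉ S → Fin k) λ c →
    ∀ u v (u∉S : u ∉ S) (v∉S : v ∉ S) → adj G u v ≡ true → c u u∉S ≢ c v v∉S

ChromDel : ∀ {n} → Graph n → Subset n → ℕ → Set
ChromDel G S k = Colouring G S k × (∀ j → Colouring G S j → k ≤ j)

Chrom : ∀ {n} → Graph n → ℕ → Set
Chrom {n} G k = ChromDel G Data.Fin.Subset.⊥ k

Independent : ∀ {n} → Graph n → Subset n → Set
Independent {n} G S = ∀ u v → u ∈ S → v ∈ S → adj G u v ≡ false

VsChrom : ∀ {n} → Graph n → ℕ → ℕ → Set
VsChrom {n} G k m =
  (∃ λ (S : Subset n) → ∣ S ∣ ≡ m × ChromDel G S (k Data.Nat.∸ 1))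
  × (∀ (S : Subset n) → ChromDel G S (k Data.Nat.∸ 1) → m ≤ ∣ S ∣)

IvsChrom : ∀ {n} → Graph n → ℕ → ℕ → Set
IvsChrom {n} G k m =
  (∃ λ (S : Subset n) → Independent G S × ∣ S ∣ ≡ m × ChromDel G S (k Data.Nat.∸ 1))
  × (∀ (S : Subset n) → Independent G S → ChromDel G S (k Data.Nat.∸ 1) → m ≤ ∣ S ∣)

-- Let G − {v₁, v₂} be 2-colourable. Since χ(G) = ivs_χ(G) = 3, no independent set of at most
-- two vertices can be deleted to reach a 2-colourable graph; in particular v₁v₂ is an edge and
-- v₁ sees both colours outside v₂, say on neighbours a and b. If these were all the neighbours
-- of v₁, then recolouring v₁ with the colour of a (resp. b) shows that v₂ is adjacent to a and
-- to b. If also ab is an edge, {v₁, v₂, a, b} is a K₄ in a 3-chromatic graph; otherwise, as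
-- Δ(G) ≤ 4, v₂ has at most one neighbour besides v₁, a, b, so some colour is missing around
-- v₂, and giving it to v₂ and the other colour to v₁ 2-colours G − {a, b}. Hence v₁ (and by
-- symmetry v₂) has degree 4, and a 2-element deleted set as promised by vs_χ(G) = 2 yields a
-- vertex of degree 4.
module Submission where

open import Defs hiding (sym)
open import Data.Nat using (ℕ; zero; suc; _≤_; _+_; _*_; z≤n; s≤s)
open import Data.Nat.Properties
  using (≤-trans; ≤-reflexive; ≤-antisym; ≤-pred; +-cancelʳ-≤; +-monoʳ-≤; +-suc; n≤1+n;
         m≤n⇒m≤n⊔o; m≤n⇒m≤o⊔n; module ≤-Reasoning)
open import Data.Bool using (true; false)
open import Data.Bool.Properties using (¬-not) renaming (_≟_ to _≟ᵇ_)
open import Data.Fin using (Fin; zero; suc; opposite)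
open import Data.Fin.Properties using (any?; _≟_; suc-injective)
open import Data.Fin.Subset using (Subset; ⁅_⁆; _∪_; _∈_; _∉_; ∣_∣; _⊆_; _-_; ⊤; Nonempty) renaming (⊥ to ∅)
open import Data.Fin.Subset.Properties
  using (_∈?_; x∈p∪q⁻; p⊆p∪q; q⊆p∪q; x∈⁅x⁆; x∈⁅y⁆⇒x≡y; x≢y⇒x∉⁅y⁆; x∉⁅y⁆⇒x≢y; ∉⊥; ∈⊤;
         ∣⁅x⁆∣≡1; ∣⊤∣≡n; ∣⊥∣≡0; nonempty?; Empty-unique; x∈p∧x≢y⇒x∈p-y; x∈p⇒∣p-x∣<∣p∣)
open import Data.List using (List; []; _∷_; length; map; allFin)
open import Data.List.Properties using (length-map; foldr-preservesᵒ)
open import Data.List.Relation.Unary.All using (All; []; _∷_)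
import Data.List.Relation.Unary.All as All
open import Data.List.Relation.Unary.All.Properties using (¬Any⇒All¬)
open import Data.List.Relation.Unary.AllPairs using (AllPairs; []; _∷_)
import Data.List.Relation.Unary.AllPairs as AllPairs
import Data.List.Relation.Unary.AllPairs.Properties as AllPairsₚ
import Data.List.Relation.Unary.Any as Any
open import Data.List.Relation.Unary.Any using (here; there)
open import Data.List.Relation.Unary.Unique.Propositional using (Unique)
open import Data.List.Membership.Propositional.Properties using (∈-map⁺; ∈-allFin)
open import Data.List.Membership.Propositional using () renaming (_∈_ to _∈ₗ_; _∉_ to _∉ₗ_)
open import Data.Vec using (tabulate; []; _∷_)
open import Data.Vec.Properties using (lookup∘tabulate; lookup⇒[]=)
open import Data.Vec.Functional using (updateAt)
open import Data.Vec.Functional.Properties using (updateAt-updates; updateAt-minimal)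
open import Data.Product using (_×_; _,_; proj₁; proj₂; ∃)
open import Data.Sum using (_⊎_; inj₁; inj₂; [_,_])
open import Data.Empty using (⊥; ⊥-elim)
open import Function using (const; _∘_)
open import Level using (Level)
open import Relation.Binary.PropositionalEquality
  using (_≡_; _≢_; refl; sym; trans; subst; cong; cong₂; ≢-sym)
open import Relation.Nullary using (¬_; Dec; yes; no; ¬?; contradiction)
open import Relation.Nullary.Decidable using (_×-dec_; decidable-stable)
open import Relation.Unary using (Pred; Decidable)

private
  variable
    ℓ : Level
    n k m : ℕ
    x y z : Fin n
    p q S T : Subset n

∣p∪q∣≤∣p∣+∣q∣ : ∀ (p q : Subset n) → ∣ p ∪ q ∣ ≤ ∣ p ∣ + ∣ q ∣
∣p∪q∣≤∣p∣+∣q∣ [] [] = z≤n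
∣p∪q∣≤∣p∣+∣q∣ (true ∷ p) (true ∷ q) = s≤s (≤-trans (∣p∪q∣≤∣p∣+∣q∣ p q) (+-monoʳ-≤ ∣ p ∣ (n≤1+n ∣ q ∣)))
∣p∪q∣≤∣p∣+∣q∣ (true ∷ p) (false ∷ q) = s≤s (∣p∪q∣≤∣p∣+∣q∣ p q)
∣p∪q∣≤∣p∣+∣q∣ (false ∷ p) (true ∷ q) rewrite +-suc ∣ p ∣ ∣ q ∣ = s≤s (∣p∪q∣≤∣p∣+∣q∣ p q)
∣p∪q∣≤∣p∣+∣q∣ (false ∷ p) (false ∷ q) = ∣p∪q∣≤∣p∣+∣q∣ p q

∣⁅x⁆∪⁅y⁆∣≤2 : ∀ (x y : Fin n) → ∣ ⁅ x ⁆ ∪ ⁅ y ⁆ ∣ ≤ 2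
∣⁅x⁆∪⁅y⁆∣≤2 x y = begin
  ∣ ⁅ x ⁆ ∪ ⁅ y ⁆ ∣    ≤⟨ ∣p∪q∣≤∣p∣+∣q∣ ⁅ x ⁆ ⁅ y ⁆ ⟩
  ∣ ⁅ x ⁆ ∣ + ∣ ⁅ y ⁆ ∣ ≡⟨ cong₂ _+_ (∣⁅x⁆∣≡1 x) (∣⁅x⁆∣≡1 y) ⟩
  2                    ∎
  where open ≤-Reasoning

x∈⁅x⁆∪p : ∀ (p : Subset n) → x ∈ ⁅ x ⁆ ∪ p
x∈⁅x⁆∪p p = p⊆p∪q p (x∈⁅x⁆ _)

x∈⁅y⁆∪⁅z⁆⇒x≡y⊎x≡z : x ∈ ⁅ y ⁆ ∪ ⁅ z ⁆ → x ≡ y ⊎ x ≡ z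
x∈⁅y⁆∪⁅z⁆⇒x≡y⊎x≡z {y = y} {z} x∈ with x∈p∪q⁻ ⁅ y ⁆ ⁅ z ⁆ x∈
... | inj₁ x∈⁅y⁆ = inj₁ (x∈⁅y⁆⇒x≡y y x∈⁅y⁆)
... | inj₂ x∈⁅z⁆ = inj₂ (x∈⁅y⁆⇒x≡y z x∈⁅z⁆)

x∉p∧x∉q⇒x∉p∪q : x ∉ p → x ∉ q → x ∉ p ∪ q
x∉p∧x∉q⇒x∉p∪q {p = p} {q} x∉p x∉q x∈ = [ x∉p , x∉q ] (x∈p∪q⁻ p q x∈)

⁅x⁆∪⁅y⁆⊆p : x ∈ p → y ∈ p → ⁅ x ⁆ ∪ ⁅ y ⁆ ⊆ p
⁅x⁆∪⁅y⁆⊆p x∈p y∈p z∈ with x∈⁅y⁆∪⁅z⁆⇒x≡y⊎x≡z z∈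
... | inj₁ refl = x∈p
... | inj₂ refl = y∈p

length≤∣p∣ : ∀ (p : Subset n) {xs : List (Fin n)} → All (_∈ p) xs → Unique xs → length xs ≤ ∣ p ∣
length≤∣p∣ p [] [] = z≤n
length≤∣p∣ p {x ∷ xs} (x∈p ∷ xs⊆p) (x∉xs ∷ xs!) = ≤-trans (s≤s (length≤∣p∣ (p - x) xs⊆p-x xs!)) (x∈p⇒∣p-x∣<∣p∣ x∈p)
  where
  xs⊆p-x : All (_∈ p - x) xs
  xs⊆p-x = All.zipWith (λ (y∈p , x≢y) → x∈p∧x≢y⇒x∈p-y y∈p (≢-sym x≢y)) (xs⊆p , x∉xs)

∣p∣≡1+k⇒Nonempty : ∀ {n k} {p : Subset n} → ∣ p ∣ ≡ suc k → Nonempty p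
∣p∣≡1+k⇒Nonempty {n} {p = p} ∣p∣≡1+k = decidable-stable (nonempty? p) λ p-empty →
  contradiction (trans (sym ∣p∣≡1+k) (trans (cong ∣_∣ (Empty-unique p-empty)) (∣⊥∣≡0 n))) λ ()

∣p∣≤2⇒⊆⁅x⁆∪⁅y⁆ : x ∈ p → ∣ p ∣ ≤ 2 → ∃ λ y → p ⊆ ⁅ x ⁆ ∪ ⁅ y ⁆
∣p∣≤2⇒⊆⁅x⁆∪⁅y⁆ {x = x} {p} x∈p ∣p∣≤2 with any? (λ y → y ∈? p ×-dec ¬? (y ≟ x))
... | no ∄y = x , λ {z} z∈p → decidable-stable (z ∈? ⁅ x ⁆ ∪ ⁅ x ⁆)
      λ z∉ → ∄y (z , z∈p , x∉⁅y⁆⇒x≢y λ z∈⁅x⁆ → z∉ (p⊆p∪q ⁅ x ⁆ z∈⁅x⁆))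
... | yes (y , y∈p , y≢x) = y , λ {z} z∈p → decidable-stable (z ∈? ⁅ x ⁆ ∪ ⁅ y ⁆)
      λ z∉ → third z z∈p (x∉⁅y⁆⇒x≢y (z∉ ∘ p⊆p∪q ⁅ y ⁆)) (x∉⁅y⁆⇒x≢y (z∉ ∘ q⊆p∪q ⁅ x ⁆ ⁅ y ⁆))
  where
  third : ∀ z → z ∈ p → z ≢ x → z ≢ y → ⊥
  third z z∈p z≢x z≢y with length≤∣p∣ p (x∈p ∷ y∈p ∷ z∈p ∷ [])
    ((≢-sym y≢x ∷ ≢-sym z≢x ∷ []) ∷ (≢-sym z≢y ∷ []) ∷ [] ∷ [])
  ... | 3≤∣p∣ = contradiction (≤-trans 3≤∣p∣ ∣p∣≤2) λ { (s≤s (s≤s ())) }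

Adj : Graph n → Fin n → Fin n → Set
Adj G u v = adj G u v ≡ true

Adj? : ∀ (G : Graph n) u v → Dec (Adj G u v)
Adj? G u v = adj G u v ≟ᵇ true

Adj-sym : ∀ (G : Graph n) {u v} → Adj G u v → Adj G v u
Adj-sym G {u} {v} u~v = trans (Graph.sym G v u) u~v

Adj-irrefl : ∀ (G : Graph n) v → ¬ Adj G v v
Adj-irrefl G v v~v with trans (sym v~v) (irrefl G v)
... | ()

Adj⇒≢ : ∀ (G : Graph n) {u v} → Adj G u v → u ≢ v
Adj⇒≢ G {u} u~v refl = Adj-irrefl G u u~v

¬Adj⇒independent : ∀ (G : Graph n) {x y} → ¬ Adj G x y → Independent G (⁅ x ⁆ ∪ ⁅ y ⁆)
¬Adj⇒independent G {x} {y} x≁y u v u∈ v∈ with x∈⁅y⁆∪⁅z⁆⇒x≡y⊎x≡z u∈ | x∈⁅y⁆∪⁅z⁆⇒x≡y⊎x≡z v∈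
... | inj₁ refl | inj₁ refl = irrefl G x
... | inj₁ refl | inj₂ refl = ¬-not x≁y
... | inj₂ refl | inj₁ refl = ¬-not (x≁y ∘ Adj-sym G)
... | inj₂ refl | inj₂ refl = irrefl G y

deg≤Δ : ∀ (G : Graph n) v → deg G v ≤ Δ G
deg≤Δ {n} G v = foldr-preservesᵒ (λ x y → [ m≤n⇒m≤n⊔o y , m≤n⇒m≤o⊔n x ]) 0 (map (deg G) (allFin n))
  (inj₂ (Any.map ≤-reflexive (∈-map⁺ (deg G) (∈-allFin v))))

length≤deg : ∀ (G : Graph n) {v} {xs : List (Fin n)} → All (Adj G v) xs → Unique xs → length xs ≤ deg G v
length≤deg G {v} neighbours = length≤∣p∣ (tabulate (adj G v)) (All.map neighbour∈ neighbours)
  where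
  neighbour∈ : ∀ {u} → Adj G v u → u ∈ tabulate (adj G v)
  neighbour∈ {u} v~u = lookup⇒[]= u _ (trans (lookup∘tabulate (adj G v) u) v~u)

extra-neighbour⇒length<deg : ∀ (G : Graph n) {v w} {xs : List (Fin n)} →
  All (Adj G v) xs → Unique xs → Adj G v w → w ∉ₗ xs → suc (length xs) ≤ deg G v
extra-neighbour⇒length<deg G neighbours xs! v~w w∉xs =
  length≤deg G (v~w ∷ neighbours) (¬Any⇒All¬ _ w∉xs ∷ xs!)

ProperOutside : Graph n → Subset n → (Fin n → Fin k) → Set
ProperOutside G S f = ∀ u v → u ∉ S → v ∉ S → Adj G u v → f u ≢ f v

proper⇒colouring : ∀ (G : Graph n) {f : Fin n → Fin k} → ProperOutside G S f → Colouring G S k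
proper⇒colouring G {f} f-proper = (λ v _ → f v) , f-proper

-- The deleted vertices get the junk colour zero.
colouring⇒proper : ∀ (G : Graph n) → Colouring G S (suc k) → ∃ (ProperOutside G S)
colouring⇒proper {S = S} {k = k} G (c , c-proper) = colour , proper
  where
  colour′ : ∀ v → Dec (v ∈ S) → Fin (suc k)
  colour′ v (yes _)   = zero
  colour′ v (no v∉S) = c v v∉S

  colour : Fin _ → Fin (suc k)
  colour v = colour′ v (v ∈? S)

  proper : ProperOutside G S colour
  proper u v u∉S v∉S u~v with u ∈? S | v ∈? S
  ... | yes u∈S | _        = contradiction u∈S u∉S
  ... | no _    | yes v∈S = contradiction v∈S v∉S
  ... | no u∉S′ | no v∉S′ = c-proper u v u∉S′ v∉S′ u~v

Colouring-mono : ∀ (G : Graph n) → S ⊆ T → Colouring G S k → Colouring G T k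
Colouring-mono G S⊆T (c , c-proper) = (λ v v∉T → c v (v∉T ∘ S⊆T)) , λ u v _ _ → c-proper u v _ _

ProperOutside-mono : ∀ (G : Graph n) {f : Fin n → Fin k} → S ⊆ T → ProperOutside G S f → ProperOutside G T f
ProperOutside-mono G S⊆T f-proper u v u∉T v∉T = f-proper u v (u∉T ∘ S⊆T) (v∉T ∘ S⊆T)

recolour : ∀ (G : Graph n) {f : Fin n → Fin k} v c → ProperOutside G (⁅ v ⁆ ∪ T) f →
  (∀ w → Adj G v w → w ∉ T → f w ≢ c) → ProperOutside G T (updateAt f v (const c))
recolour {T = T} G {f} v c f-proper c-free u w u∉T w∉T u~w with u ≟ v | w ≟ v
... | yes refl | yes refl = contradiction u~w (Adj-irrefl G u)
... | yes refl | no w≢v rewrite updateAt-updates u {const c} f | updateAt-minimal w u {const c} f w≢v =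
  ≢-sym (c-free w u~w w∉T)
... | no u≢v | yes refl rewrite updateAt-minimal u w {const c} f u≢v | updateAt-updates w {const c} f =
  c-free u (Adj-sym G u~w) u∉T
... | no u≢v | no w≢v rewrite updateAt-minimal u v {const c} f u≢v | updateAt-minimal w v {const c} f w≢v =
  f-proper u w (x∉p∧x∉q⇒x∉p∪q (x≢y⇒x∉⁅y⁆ u≢v) u∉T) (x∉p∧x∉q⇒x∉p∪q (x≢y⇒x∉⁅y⁆ w≢v) w∉T) u~w

clique-length≤ : ∀ (G : Graph n) {f : Fin n → Fin k} {xs : List (Fin n)} →
  ProperOutside G ∅ f → AllPairs (Adj G) xs → length xs ≤ k
clique-length≤ {k = k} G {f} {xs} f-proper clique = begin
  length xs         ≡⟨ sym (length-map f xs) ⟩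
  length (map f xs) ≤⟨ length≤∣p∣ ⊤ (All.tabulate (λ _ → ∈⊤)) colours-distinct ⟩
  ∣ ⊤ {k} ∣         ≡⟨ ∣⊤∣≡n k ⟩
  k                 ∎
  where
  open ≤-Reasoning
  colours-distinct : Unique (map f xs)
  colours-distinct = AllPairsₚ.map⁺ (AllPairs.map (λ {u} {v} → f-proper u v ∉⊥ ∉⊥) clique)

extend-by-independent : ∀ (G : Graph n) → Independent G S → Colouring G S k → Colouring G ∅ (suc k)
extend-by-independent {S = S} {k = k} G S-indep (c , c-proper) = (λ v _ → colour v) , λ u v _ _ → proper u v
  where
  colour′ : ∀ v → Dec (v ∈ S) → Fin (suc k)
  colour′ v (yes _)   = zero
  colour′ v (no v∉S) = suc (c v v∉S)

  colour : Fin _ → Fin (suc k)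
  colour v = colour′ v (v ∈? S)

  proper : ∀ u v → Adj G u v → colour u ≢ colour v
  proper u v u~v with u ∈? S | v ∈? S
  ... | yes u∈S | yes v∈S = contradiction (trans (sym (S-indep u v u∈S v∈S)) u~v) λ ()
  ... | yes _   | no _    = λ ()
  ... | no _    | yes _   = λ ()
  ... | no u∉S | no v∉S  = c-proper u v u∉S v∉S u~v ∘ suc-injective

ivs-bound : ∀ (G : Graph n) → Chrom G (suc k) → IvsChrom G (suc k) m →
  Independent G S → Colouring G S k → m ≤ ∣ S ∣
ivs-bound {S = S} G χ≡k+1 ivs S-indep col =
  proj₂ ivs S S-indep (col , λ j colⱼ → ≤-pred (proj₂ χ≡k+1 (suc j) (extend-by-independent G S-indep colⱼ)))

≢opposite : (c : Fin 2) → c ≢ opposite c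
≢opposite zero ()
≢opposite (suc zero) ()

missing-colour : ∀ {P : Pred (Fin n) ℓ} → Decidable P → (∀ {d e} → P d → P e → d ≡ e) →
  (f : Fin n → Fin 2) → ∃ λ c → ∀ w → P w → f w ≢ c
missing-colour P? at-most-one f with any? P?
... | no ∄P = zero , λ w Pw _ → ∄P (w , Pw)
... | yes (d , Pd) = opposite (f d) , λ w Pw → subst (λ u → f u ≢ opposite (f d)) (at-most-one Pd Pw) (≢opposite (f d))

module _ (G : Graph n) (χ≡3 : Chrom G 3) (ivs≡3 : IvsChrom G 3 3) where

  open import Data.List.Membership.DecPropositional (_≟_ {n}) using () renaming (_∈?_ to _∈ₗ?_; _∉?_ to _∉ₗ?_)

  ¬Adj⇒¬Colouring : ∀ x y → ¬ Adj G x y → ¬ Colouring G (⁅ x ⁆ ∪ ⁅ y ⁆) 2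
  ¬Adj⇒¬Colouring x y x≁y col =
    contradiction (≤-trans (ivs-bound G χ≡3 ivs≡3 (¬Adj⇒independent G x≁y) col) (∣⁅x⁆∪⁅y⁆∣≤2 x y)) λ { (s≤s (s≤s ())) }

  ¬Colouring-⁅x⁆ : ∀ x → ¬ Colouring G ⁅ x ⁆ 2
  ¬Colouring-⁅x⁆ x = ¬Adj⇒¬Colouring x x (Adj-irrefl G x) ∘ Colouring-mono G (p⊆p∪q ⁅ x ⁆)

  K₄-free : ∀ {v₁ v₂ a b} → Adj G v₁ v₂ → Adj G v₁ a → Adj G v₁ b → Adj G v₂ a → Adj G v₂ b → ¬ Adj G a b
  K₄-free v₁~v₂ v₁~a v₁~b v₂~a v₂~b a~b with colouring⇒proper G (proj₁ χ≡3)
  ... | _ , proper = contradiction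
    (clique-length≤ G proper ((v₁~v₂ ∷ v₁~a ∷ v₁~b ∷ []) ∷ (v₂~a ∷ v₂~b ∷ []) ∷ (a~b ∷ []) ∷ [] ∷ []))
    λ { (s≤s (s≤s (s≤s ()))) }

  module _ (Δ≤4 : Δ G ≤ 4) (v₁ v₂ : Fin n) (col : Colouring G (⁅ v₁ ⁆ ∪ ⁅ v₂ ⁆) 2) where

    private
      c : Fin n → Fin 2
      c = proj₁ (colouring⇒proper G col)

      c-proper : ProperOutside G (⁅ v₁ ⁆ ∪ ⁅ v₂ ⁆) c
      c-proper = proj₂ (colouring⇒proper G col)

      deg≤4 : ∀ v → deg G v ≤ 4
      deg≤4 v = ≤-trans (deg≤Δ G v) Δ≤4

    v₁~v₂ : Adj G v₁ v₂
    v₁~v₂ = decidable-stable (Adj? G v₁ v₂) λ v₁≁v₂ → ¬Adj⇒¬Colouring v₁ v₂ v₁≁v₂ col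

    v₁-sees-colour : ∀ x → ∃ λ u → Adj G v₁ u × u ∉ ⁅ v₂ ⁆ × c u ≡ x
    v₁-sees-colour x = decidable-stable (any? λ u → Adj? G v₁ u ×-dec ¬? (u ∈? ⁅ v₂ ⁆) ×-dec c u ≟ x)
      λ ∄u → ¬Colouring-⁅x⁆ v₂ (proper⇒colouring G
        (recolour G v₁ x c-proper λ w v₁~w w∉ cw≡x → ∄u (w , v₁~w , w∉ , cw≡x)))

    v₂-adjacent : ∀ y → (∀ w → Adj G v₁ w → w ∉ ⁅ v₂ ⁆ ∪ ⁅ y ⁆ → c w ≢ c y) → Adj G v₂ y
    v₂-adjacent y c-free = decidable-stable (Adj? G v₂ y) λ v₂≁y → ¬Adj⇒¬Colouring v₂ y v₂≁y
      (proper⇒colouring G (recolour G v₁ (c y) (ProperOutside-mono G ⊆⁅v₁⁆∪⁅v₂⁆∪⁅y⁆ c-proper) c-free))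
      where
      ⊆⁅v₁⁆∪⁅v₂⁆∪⁅y⁆ : ⁅ v₁ ⁆ ∪ ⁅ v₂ ⁆ ⊆ ⁅ v₁ ⁆ ∪ (⁅ v₂ ⁆ ∪ ⁅ y ⁆)
      ⊆⁅v₁⁆∪⁅v₂⁆∪⁅y⁆ = ⁅x⁆∪⁅y⁆⊆p (x∈⁅x⁆∪p _) (q⊆p∪q ⁅ v₁ ⁆ _ (x∈⁅x⁆∪p ⁅ y ⁆))

    module _ {a b} (v₁~a : Adj G v₁ a) (v₁~b : Adj G v₁ b) (ca≢cb : c a ≢ c b)
             (only : ∀ w → Adj G v₁ w → w ∈ₗ v₂ ∷ a ∷ b ∷ []) where

      private
        v₂~a : Adj G v₂ a
        v₂~a = v₂-adjacent a λ w v₁~w w∉ → case-only w (only w v₁~w) w∉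
          where
          case-only : ∀ w → w ∈ₗ v₂ ∷ a ∷ b ∷ [] → w ∉ ⁅ v₂ ⁆ ∪ ⁅ a ⁆ → c w ≢ c a
          case-only w (here refl)                 w∉ = contradiction (x∈⁅x⁆∪p _) w∉
          case-only w (there (here refl))         w∉ = contradiction (q⊆p∪q ⁅ v₂ ⁆ _ (x∈⁅x⁆ w)) w∉
          case-only w (there (there (here refl))) _  = ≢-sym ca≢cb

        v₂~b : Adj G v₂ b
        v₂~b = v₂-adjacent b λ w v₁~w w∉ → case-only w (only w v₁~w) w∉
          where
          case-only : ∀ w → w ∈ₗ v₂ ∷ a ∷ b ∷ [] → w ∉ ⁅ v₂ ⁆ ∪ ⁅ b ⁆ → c w ≢ c b
          case-only w (here refl)                 w∉ = contradiction (x∈⁅x⁆∪p _) w∉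
          case-only w (there (here refl))         _  = ca≢cb
          case-only w (there (there (here refl))) w∉ = contradiction (q⊆p∪q ⁅ v₂ ⁆ _ (x∈⁅x⁆ w)) w∉

        -- Counting v₁, a, b and two further neighbours would give v₂ degree 5.
        at-most-one-other : ∀ {d e} → Adj G v₂ d × d ∉ₗ v₁ ∷ a ∷ b ∷ [] →
                                      Adj G v₂ e × e ∉ₗ v₁ ∷ a ∷ b ∷ [] → d ≡ e
        at-most-one-other {d} {e} (v₂~d , d∉) (v₂~e , e∉) = decidable-stable (d ≟ e) λ d≢e →
          contradiction (≤-trans (extra-neighbour⇒length<deg G
              (v₂~d ∷ Adj-sym G v₁~v₂ ∷ v₂~a ∷ v₂~b ∷ [])
              (¬Any⇒All¬ _ d∉ ∷ (Adj⇒≢ G v₁~a ∷ Adj⇒≢ G v₁~b ∷ []) ∷ (a≢b ∷ []) ∷ [] ∷ [])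
              v₂~e λ { (here e≡d) → d≢e (sym e≡d) ; (there e∈) → e∉ e∈ })
            (deg≤4 v₂))
            λ { (s≤s (s≤s (s≤s (s≤s ())))) }
          where
          a≢b : a ≢ b
          a≢b = ca≢cb ∘ cong c

        a≁b : ¬ Adj G a b
        a≁b = K₄-free v₁~v₂ v₁~a v₁~b v₂~a v₂~b

      three-neighbours-impossible : ⊥
      three-neighbours-impossible =
        recolour-v₁-v₂ (missing-colour (λ w → Adj? G v₂ w ×-dec w ∉ₗ? v₁ ∷ a ∷ b ∷ []) at-most-one-other c)
        where
        recolour-v₁-v₂ : (∃ λ x → ∀ w → Adj G v₂ w × w ∉ₗ v₁ ∷ a ∷ b ∷ [] → c w ≢ x) → ⊥
        recolour-v₁-v₂ (x , x-free) = ¬Adj⇒¬Colouring a b a≁b (proper⇒colouring G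
          (recolour G v₁ (opposite x) (recolour G v₂ x (ProperOutside-mono G ⊆⁅v₂⁆∪⁅v₁⁆∪⁅a⁆∪⁅b⁆ c-proper) v₂-free)
            v₁-free))
          where
          ⊆⁅v₂⁆∪⁅v₁⁆∪⁅a⁆∪⁅b⁆ : ⁅ v₁ ⁆ ∪ ⁅ v₂ ⁆ ⊆ ⁅ v₂ ⁆ ∪ (⁅ v₁ ⁆ ∪ (⁅ a ⁆ ∪ ⁅ b ⁆))
          ⊆⁅v₂⁆∪⁅v₁⁆∪⁅a⁆∪⁅b⁆ = ⁅x⁆∪⁅y⁆⊆p (q⊆p∪q ⁅ v₂ ⁆ _ (x∈⁅x⁆∪p _)) (x∈⁅x⁆∪p _)

          v₂-free : ∀ w → Adj G v₂ w → w ∉ ⁅ v₁ ⁆ ∪ (⁅ a ⁆ ∪ ⁅ b ⁆) → c w ≢ x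
          v₂-free w v₂~w w∉ = x-free w (v₂~w , λ
            { (here refl)                 → w∉ (x∈⁅x⁆∪p _)
            ; (there (here refl))         → w∉ (q⊆p∪q ⁅ v₁ ⁆ _ (x∈⁅x⁆∪p _))
            ; (there (there (here refl))) → w∉ (q⊆p∪q ⁅ v₁ ⁆ _ (q⊆p∪q ⁅ a ⁆ _ (x∈⁅x⁆ w))) })

          v₁-free : ∀ w → Adj G v₁ w → w ∉ ⁅ a ⁆ ∪ ⁅ b ⁆ → updateAt c v₂ (const x) w ≢ opposite x
          v₁-free w v₁~w w∉ with only w v₁~w
          ... | here refl rewrite updateAt-updates w {const x} c = ≢opposite x
          ... | there (here refl)         = contradiction (x∈⁅x⁆∪p _) w∉
          ... | there (there (here refl)) = contradiction (q⊆p∪q ⁅ a ⁆ _ (x∈⁅x⁆ w)) w∉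

    deg-v₁≡4 : deg G v₁ ≡ 4
    deg-v₁≡4 with v₁-sees-colour zero | v₁-sees-colour (suc zero)
    ... | a , v₁~a , a∉ , ca≡0 | b , v₁~b , b∉ , cb≡1 = ≤-antisym (deg≤4 v₁) four-neighbours
      where
      ca≢cb : c a ≢ c b
      ca≢cb ca≡cb with trans (sym ca≡0) (trans ca≡cb cb≡1)
      ... | ()

      four-neighbours : 4 ≤ deg G v₁
      four-neighbours with any? (λ w → Adj? G v₁ w ×-dec w ∉ₗ? v₂ ∷ a ∷ b ∷ [])
      ... | yes (w , v₁~w , w∉) = extra-neighbour⇒length<deg G (v₁~v₂ ∷ v₁~a ∷ v₁~b ∷ [])
            ((≢-sym (x∉⁅y⁆⇒x≢y a∉) ∷ ≢-sym (x∉⁅y⁆⇒x≢y b∉) ∷ []) ∷ ((ca≢cb ∘ cong c) ∷ []) ∷ [] ∷ [])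
            v₁~w w∉
      ... | no ∄w = ⊥-elim (three-neighbours-impossible v₁~a v₁~b ca≢cb
            λ w v₁~w → decidable-stable (w ∈ₗ? v₂ ∷ a ∷ b ∷ []) λ w∉ → ∄w (w , v₁~w , w∉))

lemma7 : ∀ {n} (G : Graph n) →
    Chrom G 3 → IvsChrom G 3 3 → VsChrom G 3 2 → Δ G + 2 ≤ 2 * 3 →
    Δ G ≡ 4 × (∀ (v₁ v₂ : Fin n) → ChromDel G (⁅ v₁ ⁆ ∪ ⁅ v₂ ⁆) 2 → deg G v₁ ≡ 4 × deg G v₂ ≡ 4)
lemma7 G χ≡3 ivs≡3 ((S , ∣S∣≡2 , χ[G-S]≡2) , _) Δ+2≤6 =
  ≤-antisym Δ≤4 4≤Δ , λ v₁ v₂ χ≡2 → deg≡4 v₁ v₂ (proj₁ χ≡2) , deg≡4 v₂ v₁ (Colouring-mono G swap (proj₁ χ≡2))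
  where
  Δ≤4 : Δ G ≤ 4
  Δ≤4 = +-cancelʳ-≤ 2 (Δ G) 4 Δ+2≤6

  deg≡4 : ∀ v₁ v₂ → Colouring G (⁅ v₁ ⁆ ∪ ⁅ v₂ ⁆) 2 → deg G v₁ ≡ 4
  deg≡4 = deg-v₁≡4 G χ≡3 ivs≡3 Δ≤4

  swap : ∀ {v₁ v₂} → ⁅ v₁ ⁆ ∪ ⁅ v₂ ⁆ ⊆ ⁅ v₂ ⁆ ∪ ⁅ v₁ ⁆
  swap {v₁} {v₂} = ⁅x⁆∪⁅y⁆⊆p (q⊆p∪q ⁅ v₂ ⁆ _ (x∈⁅x⁆ v₁)) (x∈⁅x⁆∪p _)

  4≤Δ : 4 ≤ Δ G
  4≤Δ with ∣p∣≡1+k⇒Nonempty ∣S∣≡2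
  ... | x , x∈S with ∣p∣≤2⇒⊆⁅x⁆∪⁅y⁆ x∈S (≤-reflexive ∣S∣≡2)
  ... | y , S⊆ = subst (_≤ Δ G) (deg≡4 x y (Colouring-mono G S⊆ (proj₁ χ[G-S]≡2))) (deg≤Δ G x)
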